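{- There is an absolute constant $c>0$ such that for every odd $n$ there is a mapping $\phi$ from $\mathrm{XOR}$ to $\mathrm{Majority}$ on $\{0,1\}^n$ with $\mathrm{avgStretch}(\phi)\le c\sqrt{n}$, i.e. $\mathrm{avgStretch}(\phi)=O(\sqrt n)$.
   Context: For $x,y\in\{0,1\}^n$, $|x|=\sum_i x_i$ and $\mathrm{dist}(x,y)=\sum_i|x_i-y_i|$. $\mathrm{XOR}(x)=\sum_i x_i \bmod 2$; $\mathrm{Majority}(x)=1$ if $|x|>n/2$ and $0$ otherwise. A mapping from $f$ to $g$ is a bijection $\phi:\{0,1\}^n\to\{0,1\}^n$ with $f(x)=g(\phi(x))$ for all $x$. The average stretch is $\mathrm{avgStretch}(\phi)=\mathbb{E}_{x,i}[\mathrm{dist}(\phi(x),\phi(x+e_i))]$ where $x\in\{0,1\}^n$ and $i\in[n]$ are independent and uniform, $e_i$ the $i$th standard basis vector, addition mod 2. -}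

module Defs where

open import Data.Bool using (Bool; true; false; not; _xor_; if_then_else_)
open import Data.Nat using (ℕ; zero; suc; _+_; _*_; _<ᵇ_)
open import Data.Vec using (Vec; []; _∷_; zipWith; updateAt; foldr)
open import Data.Fin using (Fin)
open import Data.Nat.ListAction using (sum)
open import Data.List using (List; _++_; map; allFin) renaming ([] to []ᴸ; _∷_ to _∷ᴸ_)
open import Relation.Binary.PropositionalEquality using (_≡_)
open import Function.Bundles using (_⤖_; Bijection)

-- The hypercube {0,1}^n, with true = 1, false = 0.
Cube : ℕ → Set
Cube n = Vec Bool n

weight : ∀ {n} → Cube n → ℕ
weight = foldr (λ _ → ℕ) (λ b w → (if b then 1 else 0) + w) 0

dist : ∀ {n} → Cube n → Cube n → ℕ
dist x y = weight (zipWith _xor_ x y)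

XOR : ∀ {n} → Cube n → Bool
XOR = foldr (λ _ → Bool) _xor_ false

-- Majority(x) = 1 iff |x| > n/2, i.e. n < 2|x|
Majority : ∀ {n} → Cube n → Bool
Majority {n} x = n <ᵇ (2 * weight x)

flipAt : ∀ {n} → Fin n → Cube n → Cube n
flipAt i x = updateAt x i not

allCube : (n : ℕ) → List (Cube n)
allCube zero = [] ∷ᴸ []ᴸ
allCube (suc n) = map (false ∷_) (allCube n) ++ map (true ∷_) (allCube n)

record Mapping (n : ℕ) (f g : Cube n → Bool) : Set where
  field
    φ       : Cube n ⤖ Cube n
    respects : ∀ x → f x ≡ g (Bijection.to φ x)

-- Total stretch  Σ_x Σ_i dist(φ x, φ (x + e_i)) = n · 2^n · avgStretch(φ)
totalStretch : ∀ {n} → (Cube n → Cube n) → ℕ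
totalStretch {n} φ =
  sum (map (λ x → sum (map (λ i → dist (φ x) (φ (flipAt i x))) (allFin n))) (allCube n))

-- Read 0 as an opening and 1 as a closing bracket. The matched pairs of x
-- are fixed along its symmetric chain (Greene–Kleitman), whose points differ
-- only in the unmatched positions, a block 1^k 0^(u-k). Reflecting the chain,
-- k ↦ u - k, is an involution that exchanges weight and number of zeros and
-- moves x by exactly its imbalance ∣|x| - (n - |x|)∣. For odd n it therefore
-- flips both XOR and Majority, so applying it exactly where XOR and Majority
-- disagree gives a mapping from XOR to Majority. An edge x, x + e_i is stretched
-- by at most 2·imbalance(x) + 3, and Σ_x imbalance(x)² = n·2^n, so by
-- Cauchy–Schwarz Σ_x imbalance(x) ≤ √n·2^n and the total stretch is O(n^{3/2}·2^n).

module Submission where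

open import Defs
open import Data.Bool using (Bool; true; false; not; _xor_; if_then_else_; _≟_)
open import Data.Bool.Properties
  using (xor-comm; xor-same; not-distribˡ-xor; not-distribʳ-xor; not-injective; ¬-not)
open import Data.Fin using (Fin; zero; suc)
open import Data.List using (List; []; _∷_; _++_; map; length; allFin)
open import Data.List.Properties using (map-++; length-++; length-map; length-tabulate)
open import Data.Nat
  using ( ℕ; zero; suc; pred; _+_; _*_; _^_; _%_; _/_; ∣_-_∣
        ; _≤_; _<_; _<ᵇ_; z≤n; s≤s; s≤s⁻¹ )
open import Data.Nat.DivMod using (m≡m%n+[m/n]*n)
open import Data.Nat.ListAction using (sum)
open import Data.Nat.ListAction.Properties using (sum-++)
open import Data.Nat.Properties
  using ( +-comm; +-suc; +-identityʳ; +-cancelʳ-≡; suc-injective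
        ; *-comm; *-identityˡ; *-identityʳ; *-zeroʳ; *-distribˡ-+; ^-*-assoc
        ; ≤-reflexive; ≤-trans; <-irrefl; n<1+n; ≮⇒≥; m≤m+n; m≤n+m
        ; +-mono-≤; +-monoʳ-≤; *-mono-≤; *-monoˡ-≤; *-monoʳ-≤; *-cancelˡ-≤; *-cancelˡ-<
        ; <ᵇ-reflects-<; ∣-∣-comm; ∣-∣-identityʳ; ∣m+n-m+o∣≡∣n-o∣
        ; +-commutativeSemigroup; module ≤-Reasoning )
open import Algebra.Properties.CommutativeSemigroup +-commutativeSemigroup
  using () renaming (interchange to +-interchange)
open import Data.Nat.Tactic.RingSolver using (solve-∀)
open import Data.Product using (∃-syntax; _×_; _,_)
open import Data.Sum using (_⊎_; inj₁; inj₂)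
open import Data.Vec using ([]; _∷_)
open import Function using (_∘_; id)
open import Function.Bundles using (Bijection; mk↔ₛ′)
open import Function.Properties.Inverse using (↔⇒⤖)
open import Relation.Binary.PropositionalEquality
open import Relation.Nullary using (yes; no; contradiction)
open import Relation.Nullary.Reflects using (ofʸ; ofⁿ)

∑ : {A : Set} → List A → (A → ℕ) → ℕ
∑ xs f = sum (map f xs)

module _ {A : Set} where

  ∑-cong : (xs : List A) {f g : A → ℕ} → (∀ x → f x ≡ g x) → ∑ xs f ≡ ∑ xs g
  ∑-cong []       f≡g = refl
  ∑-cong (x ∷ xs) f≡g = cong₂ _+_ (f≡g x) (∑-cong xs f≡g)

  ∑-mono-≤ : (xs : List A) {f g : A → ℕ} → (∀ x → f x ≤ g x) → ∑ xs f ≤ ∑ xs g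
  ∑-mono-≤ []       f≤g = z≤n
  ∑-mono-≤ (x ∷ xs) f≤g = +-mono-≤ (f≤g x) (∑-mono-≤ xs f≤g)

  ∑-+ : (xs : List A) (f g : A → ℕ) → ∑ xs (λ x → f x + g x) ≡ ∑ xs f + ∑ xs g
  ∑-+ []       f g = refl
  ∑-+ (x ∷ xs) f g = trans (cong (f x + g x +_) (∑-+ xs f g)) (+-interchange (f x) (g x) _ _)

  ∑-*ˡ : (xs : List A) (c : ℕ) (f : A → ℕ) → ∑ xs (λ x → c * f x) ≡ c * ∑ xs f
  ∑-*ˡ []       c f = sym (*-zeroʳ c)
  ∑-*ˡ (x ∷ xs) c f = trans (cong (c * f x +_) (∑-*ˡ xs c f)) (sym (*-distribˡ-+ c (f x) (∑ xs f)))

  ∑-const : (xs : List A) (c : ℕ) → ∑ xs (λ _ → c) ≡ length xs * c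
  ∑-const []       c = refl
  ∑-const (x ∷ xs) c = cong (c +_) (∑-const xs c)

  ∑-≤-length-* : (xs : List A) {f : A → ℕ} {c : ℕ} →
                 (∀ x → f x ≤ c) → ∑ xs f ≤ length xs * c
  ∑-≤-length-* xs {c = c} f≤c = ≤-trans (∑-mono-≤ xs f≤c) (≤-reflexive (∑-const xs c))

  ∑-++ : (xs ys : List A) (f : A → ℕ) → ∑ (xs ++ ys) f ≡ ∑ xs f + ∑ ys f
  ∑-++ xs ys f = trans (cong sum (map-++ f xs ys)) (sum-++ (map f xs) (map f ys))

∑-map : {A B : Set} (xs : List A) (g : A → B) (f : B → ℕ) → ∑ (map g xs) f ≡ ∑ xs (f ∘ g)
∑-map []       g f = refl
∑-map (x ∷ xs) g f = cong (f (g x) +_) (∑-map xs g f)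

-- Cauchy–Schwarz for sums of natural numbers

m²+n²≡2mn+∣m-n∣² : ∀ m n → m * m + n * n ≡ 2 * m * n + ∣ m - n ∣ * ∣ m - n ∣
m²+n²≡2mn+∣m-n∣² zero    n       = refl
m²+n²≡2mn+∣m-n∣² (suc m) zero    = base m
  where
  base : ∀ m → (1 + m) * (1 + m) + 0 ≡ 2 * (1 + m) * 0 + (1 + m) * (1 + m)
  base = solve-∀
m²+n²≡2mn+∣m-n∣² (suc m) (suc n) = begin
  suc m * suc m + suc n * suc n          ≡⟨ expand m n ⟩
  (m * m + n * n) + 2 * (m + n + 1)      ≡⟨ cong (_+ 2 * (m + n + 1)) (m²+n²≡2mn+∣m-n∣² m n) ⟩
  (2 * m * n + d * d) + 2 * (m + n + 1)  ≡⟨ collect m n d ⟩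
  2 * suc m * suc n + d * d              ∎
  where
  open ≡-Reasoning
  d = ∣ m - n ∣
  expand : ∀ m n → (1 + m) * (1 + m) + (1 + n) * (1 + n) ≡ (m * m + n * n) + 2 * (m + n + 1)
  expand = solve-∀
  collect : ∀ m n d → (2 * m * n + d * d) + 2 * (m + n + 1) ≡ 2 * (1 + m) * (1 + n) + d * d
  collect = solve-∀

2mn≤m²+n² : ∀ m n → 2 * m * n ≤ m * m + n * n
2mn≤m²+n² m n = ≤-trans (m≤m+n (2 * m * n) _) (≤-reflexive (sym (m²+n²≡2mn+∣m-n∣² m n)))

[m+n]²≤2[m²+n²] : ∀ m n → (m + n) * (m + n) ≤ 2 * (m * m + n * n)
[m+n]²≤2[m²+n²] m n = begin
  (m + n) * (m + n)                 ≡⟨ expand m n ⟩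
  (m * m + n * n) + 2 * m * n       ≤⟨ +-monoʳ-≤ (m * m + n * n) (2mn≤m²+n² m n) ⟩
  (m * m + n * n) + (m * m + n * n) ≡⟨ double (m * m + n * n) ⟩
  2 * (m * m + n * n)               ∎
  where
  open ≤-Reasoning
  expand : ∀ m n → (m + n) * (m + n) ≡ (m * m + n * n) + 2 * m * n
  expand = solve-∀
  double : ∀ a → a + a ≡ 2 * a
  double = solve-∀

∑²≤length*∑² : {A : Set} (xs : List A) (f : A → ℕ) →
  ∑ xs f * ∑ xs f ≤ length xs * ∑ xs (λ x → f x * f x)
∑²≤length*∑² []       f = z≤n
∑²≤length*∑² (x ∷ xs) f = begin
  (a + s) * (a + s)               ≡⟨ expand a s ⟩
  a * a + 2 * a * s + s * s       ≤⟨ +-mono-≤ (+-monoʳ-≤ _ cross) (∑²≤length*∑² xs f) ⟩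
  a * a + (ℓ * (a * a) + q) + ℓ * q ≡⟨ collect a ℓ q ⟩
  suc ℓ * (a * a + q)             ∎
  where
  open ≤-Reasoning
  a = f x
  s = ∑ xs f
  q = ∑ xs (λ y → f y * f y)
  ℓ = length xs
  cross : 2 * a * s ≤ ℓ * (a * a) + q
  cross = begin
    2 * a * s                        ≡⟨ sym (∑-*ˡ xs (2 * a) f) ⟩
    ∑ xs (λ y → 2 * a * f y)         ≤⟨ ∑-mono-≤ xs (λ y → 2mn≤m²+n² a (f y)) ⟩
    ∑ xs (λ y → a * a + f y * f y)   ≡⟨ ∑-+ xs (λ _ → a * a) (λ y → f y * f y) ⟩
    ∑ xs (λ _ → a * a) + q           ≡⟨ cong (_+ q) (∑-const xs (a * a)) ⟩
    ℓ * (a * a) + q                  ∎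
  expand : ∀ a s → (a + s) * (a + s) ≡ a * a + 2 * a * s + s * s
  expand = solve-∀
  collect : ∀ a ℓ q → a * a + (ℓ * (a * a) + q) + ℓ * q ≡ (1 + ℓ) * (a * a + q)
  collect = solve-∀

bit : Bool → ℕ
bit b = if b then 1 else 0

bit-xor-triangle : ∀ a b c → bit (a xor c) ≤ bit (a xor b) + bit (b xor c)
bit-xor-triangle true  true  true  = z≤n
bit-xor-triangle true  true  false = s≤s z≤n
bit-xor-triangle true  false true  = z≤n
bit-xor-triangle true  false false = s≤s z≤n
bit-xor-triangle false true  true  = s≤s z≤n
bit-xor-triangle false true  false = z≤n
bit-xor-triangle false false true  = s≤s z≤n
bit-xor-triangle false false false = z≤n

dist-triangle : ∀ {n} (x y z : Cube n) → dist x z ≤ dist x y + dist y z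
dist-triangle []      []      []      = z≤n
dist-triangle (a ∷ x) (b ∷ y) (c ∷ z) = begin
  bit (a xor c) + dist x z
    ≤⟨ +-mono-≤ (bit-xor-triangle a b c) (dist-triangle x y z) ⟩
  (bit (a xor b) + bit (b xor c)) + (dist x y + dist y z)
    ≡⟨ +-interchange (bit (a xor b)) _ _ _ ⟩
  (bit (a xor b) + dist x y) + (bit (b xor c) + dist y z) ∎
  where open ≤-Reasoning

dist-sym : ∀ {n} (x y : Cube n) → dist x y ≡ dist y x
dist-sym []      []      = refl
dist-sym (a ∷ x) (b ∷ y) = cong₂ _+_ (cong bit (xor-comm a b)) (dist-sym x y)

dist-self : ∀ {n} (x : Cube n) → dist x x ≡ 0
dist-self []      = refl
dist-self (a ∷ x) = cong₂ _+_ (cong bit (xor-same a)) (dist-self x)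

dist-flipAt : ∀ {n} (i : Fin n) (x : Cube n) → dist x (flipAt i x) ≡ 1
dist-flipAt zero    (a ∷ x) =
  cong₂ _+_ (cong bit (trans (sym (not-distribʳ-xor a a)) (cong not (xor-same a)))) (dist-self x)
dist-flipAt (suc i) (a ∷ x) =
  trans (cong (λ b → bit b + dist x (flipAt i x)) (xor-same a)) (dist-flipAt i x)

zeros : ∀ {n} → Cube n → ℕ
zeros []          = 0
zeros (true ∷ x)  = zeros x
zeros (false ∷ x) = suc (zeros x)

weight+zeros≡n : ∀ {n} (x : Cube n) → weight x + zeros x ≡ n
weight+zeros≡n []          = refl
weight+zeros≡n (true ∷ x)  = cong suc (weight+zeros≡n x)
weight+zeros≡n (false ∷ x) = trans (+-suc (weight x) (zeros x)) (cong suc (weight+zeros≡n x))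

imbalance : ∀ {n} → Cube n → ℕ
imbalance x = ∣ weight x - zeros x ∣

flipAt-moves-one : ∀ {n} (i : Fin n) (x : Cube n) →
  (weight (flipAt i x) ≡ suc (weight x) × suc (zeros (flipAt i x)) ≡ zeros x) ⊎
  (suc (weight (flipAt i x)) ≡ weight x × zeros (flipAt i x) ≡ suc (zeros x))
flipAt-moves-one zero    (true ∷ x)  = inj₂ (refl , refl)
flipAt-moves-one zero    (false ∷ x) = inj₁ (refl , refl)
flipAt-moves-one (suc i) (true ∷ x)  with flipAt-moves-one i x
... | inj₁ (w≡ , z≡) = inj₁ (cong suc w≡ , z≡)
... | inj₂ (w≡ , z≡) = inj₂ (cong suc w≡ , z≡)
flipAt-moves-one (suc i) (false ∷ x) with flipAt-moves-one i x
... | inj₁ (w≡ , z≡) = inj₁ (w≡ , cong suc z≡)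
... | inj₂ (w≡ , z≡) = inj₂ (w≡ , cong suc z≡)

∣1+m-n∣≤∣m-1+n∣+2 : ∀ m n → ∣ suc m - n ∣ ≤ ∣ m - suc n ∣ + 2
∣1+m-n∣≤∣m-1+n∣+2 zero    zero    = s≤s z≤n
∣1+m-n∣≤∣m-1+n∣+2 zero    (suc n) = ≤-trans (m≤n+m n 2) (m≤m+n (2 + n) 2)
∣1+m-n∣≤∣m-1+n∣+2 (suc m) zero    rewrite ∣-∣-identityʳ m = ≤-reflexive (+-comm 2 m)
∣1+m-n∣≤∣m-1+n∣+2 (suc m) (suc n) = ∣1+m-n∣≤∣m-1+n∣+2 m n

imbalance-flipAt : ∀ {n} (i : Fin n) (x : Cube n) → imbalance (flipAt i x) ≤ imbalance x + 2
imbalance-flipAt i x with flipAt-moves-one i x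
... | inj₁ (w≡ , z≡) rewrite w≡ | sym z≡ =
  ∣1+m-n∣≤∣m-1+n∣+2 (weight x) (zeros (flipAt i x))
... | inj₂ (w≡ , z≡) rewrite z≡ | sym w≡ =
  subst₂ (λ a b → a ≤ b + 2) (∣-∣-comm (suc (zeros x)) (weight (flipAt i x)))
         (∣-∣-comm (zeros x) (suc (weight (flipAt i x))))
         (∣1+m-n∣≤∣m-1+n∣+2 (zeros x) (weight (flipAt i x)))

length-allCube : ∀ n → length (allCube n) ≡ 2 ^ n
length-allCube zero    = refl
length-allCube (suc n) = begin
  length (map (false ∷_) (allCube n) ++ map (true ∷_) (allCube n))
    ≡⟨ length-++ (map (false ∷_) (allCube n)) ⟩
  length (map (false ∷_) (allCube n)) + length (map (true ∷_) (allCube n))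
    ≡⟨ cong₂ _+_ (length-map (false ∷_) (allCube n)) (length-map (true ∷_) (allCube n)) ⟩
  length (allCube n) + length (allCube n)
    ≡⟨ cong (λ ℓ → ℓ + ℓ) (length-allCube n) ⟩
  2 ^ n + 2 ^ n
    ≡⟨ cong (2 ^ n +_) (sym (+-identityʳ (2 ^ n))) ⟩
  2 * 2 ^ n ∎
  where open ≡-Reasoning

∑-allCube-suc : ∀ n (f : Cube (suc n) → ℕ) →
  ∑ (allCube (suc n)) f ≡ ∑ (allCube n) (λ x → f (false ∷ x) + f (true ∷ x))
∑-allCube-suc n f = begin
  ∑ (map (false ∷_) (allCube n) ++ map (true ∷_) (allCube n)) f
    ≡⟨ ∑-++ (map (false ∷_) (allCube n)) _ f ⟩
  ∑ (map (false ∷_) (allCube n)) f + ∑ (map (true ∷_) (allCube n)) f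
    ≡⟨ cong₂ _+_ (∑-map (allCube n) (false ∷_) f) (∑-map (allCube n) (true ∷_) f) ⟩
  ∑ (allCube n) (λ x → f (false ∷ x)) + ∑ (allCube n) (λ x → f (true ∷ x))
    ≡⟨ sym (∑-+ (allCube n) _ _) ⟩
  ∑ (allCube n) (λ x → f (false ∷ x) + f (true ∷ x)) ∎
  where open ≡-Reasoning

∣-∣²-neighbours : ∀ w z →
  ∣ w - suc z ∣ * ∣ w - suc z ∣ + ∣ suc w - z ∣ * ∣ suc w - z ∣ ≡
  2 * (∣ w - z ∣ * ∣ w - z ∣) + 2
∣-∣²-neighbours zero    zero    = refl
∣-∣²-neighbours zero    (suc z) = identity z
  where
  identity : ∀ z → (2 + z) * (2 + z) + z * z ≡ 2 * ((1 + z) * (1 + z)) + 2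
  identity = solve-∀
∣-∣²-neighbours (suc w) zero    rewrite ∣-∣-identityʳ w = identity w
  where
  identity : ∀ w → w * w + (2 + w) * (2 + w) ≡ 2 * ((1 + w) * (1 + w)) + 2
  identity = solve-∀
∣-∣²-neighbours (suc w) (suc z) = ∣-∣²-neighbours w z

∑-imbalance² : ∀ n → ∑ (allCube n) (λ x → imbalance x * imbalance x) ≡ n * 2 ^ n
∑-imbalance² zero    = refl
∑-imbalance² (suc n) = begin
  ∑ (allCube (suc n)) imbalance²
    ≡⟨ ∑-allCube-suc n imbalance² ⟩
  ∑ (allCube n) (λ x → imbalance² (false ∷ x) + imbalance² (true ∷ x))
    ≡⟨ ∑-cong (allCube n) (λ x → ∣-∣²-neighbours (weight x) (zeros x)) ⟩
  ∑ (allCube n) (λ x → 2 * imbalance² x + 2)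
    ≡⟨ ∑-+ (allCube n) _ _ ⟩
  ∑ (allCube n) (λ x → 2 * imbalance² x) + ∑ (allCube n) (λ _ → 2)
    ≡⟨ cong₂ _+_ (∑-*ˡ (allCube n) 2 imbalance²) (∑-const (allCube n) 2) ⟩
  2 * ∑ (allCube n) imbalance² + length (allCube n) * 2
    ≡⟨ cong₂ (λ a b → 2 * a + b * 2) (∑-imbalance² n) (length-allCube n) ⟩
  2 * (n * 2 ^ n) + 2 ^ n * 2
    ≡⟨ collect n (2 ^ n) ⟩
  suc n * (2 * 2 ^ n) ∎
  where
  open ≡-Reasoning
  imbalance² : ∀ {m} → Cube m → ℕ
  imbalance² x = imbalance x * imbalance x
  collect : ∀ n p → 2 * (n * p) + p * 2 ≡ (1 + n) * (2 * p)
  collect = solve-∀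

-- Symmetric chains from bracket matching

-- unmatched₁ x and unmatched₀ x count the unmatched 1s and 0s of x; every
-- unmatched 1 lies to the left of every unmatched 0. For k ≤ unmatched x,
-- chainAt k x keeps the matched pairs and rewrites the unmatched block as
-- 1^k 0^(unmatched x - k).

unmatched₁ : ∀ {n} → Cube n → ℕ
unmatched₁ []          = 0
unmatched₁ (true ∷ x)  = suc (unmatched₁ x)
unmatched₁ (false ∷ x) = pred (unmatched₁ x)

unmatched₀ : ∀ {n} → Cube n → ℕ
unmatched₀ []          = 0
unmatched₀ (true ∷ x)  = unmatched₀ x
unmatched₀ (false ∷ x) = if 0 <ᵇ unmatched₁ x then unmatched₀ x else suc (unmatched₀ x)

matched : ∀ {n} → Cube n → ℕ
matched []          = 0
matched (true ∷ x)  = matched x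
matched (false ∷ x) = if 0 <ᵇ unmatched₁ x then suc (matched x) else matched x

unmatched : ∀ {n} → Cube n → ℕ
unmatched x = unmatched₁ x + unmatched₀ x

chainAt : ∀ {n} → ℕ → Cube n → Cube n
chainAt k []          = []
chainAt k (true ∷ x)  = (0 <ᵇ k) ∷ chainAt (pred k) x
chainAt k (false ∷ x) =
  if 0 <ᵇ unmatched₁ x then false ∷ chainAt (suc k) x else (0 <ᵇ k) ∷ chainAt (pred k) x

weight≡matched+unmatched₁ : ∀ {n} (x : Cube n) → weight x ≡ matched x + unmatched₁ x
weight≡matched+unmatched₁ []          = refl
weight≡matched+unmatched₁ (true ∷ x)  =
  trans (cong suc (weight≡matched+unmatched₁ x)) (sym (+-suc (matched x) (unmatched₁ x)))
weight≡matched+unmatched₁ (false ∷ x) with unmatched₁ x | weight≡matched+unmatched₁ x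
... | zero  | eq = eq
... | suc a | eq = trans eq (+-suc (matched x) a)

zeros≡matched+unmatched₀ : ∀ {n} (x : Cube n) → zeros x ≡ matched x + unmatched₀ x
zeros≡matched+unmatched₀ []          = refl
zeros≡matched+unmatched₀ (true ∷ x)  = zeros≡matched+unmatched₀ x
zeros≡matched+unmatched₀ (false ∷ x) with unmatched₁ x | zeros≡matched+unmatched₀ x
... | zero  | eq = trans (cong suc eq) (sym (+-suc (matched x) (unmatched₀ x)))
... | suc _ | eq = cong suc eq

chainAt-unmatched₁ : ∀ {n} (x : Cube n) → chainAt (unmatched₁ x) x ≡ x
chainAt-unmatched₁ []          = refl
chainAt-unmatched₁ (true ∷ x)  = cong (true ∷_) (chainAt-unmatched₁ x)
chainAt-unmatched₁ (false ∷ x) with unmatched₁ x | chainAt-unmatched₁ x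
... | zero  | eq = cong (false ∷_) eq
... | suc _ | eq = cong (false ∷_) eq

unmatched₁-chainAt : ∀ {n} k (x : Cube n) → k ≤ unmatched x → unmatched₁ (chainAt k x) ≡ k
unmatched₁-chainAt zero    []          _       = refl
unmatched₁-chainAt zero    (true ∷ x)  _       = cong pred (unmatched₁-chainAt 0 x z≤n)
unmatched₁-chainAt (suc k) (true ∷ x)  (s≤s p) = cong suc (unmatched₁-chainAt k x p)
unmatched₁-chainAt k (false ∷ x) p
  with unmatched₁ x | unmatched₁-chainAt (pred k) x | unmatched₁-chainAt (suc k) x
unmatched₁-chainAt zero    (false ∷ x) _       | zero  | ih | _  = cong pred (ih z≤n)
unmatched₁-chainAt (suc k) (false ∷ x) (s≤s p) | zero  | ih | _  = cong suc (ih p)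
unmatched₁-chainAt k       (false ∷ x) p       | suc _ | _  | ih = cong pred (ih (s≤s p))

unmatched₀-chainAt : ∀ {n} k (x : Cube n) → k ≤ unmatched x →
  unmatched₀ (chainAt k x) + k ≡ unmatched x
unmatched₀-chainAt zero    []          _       = refl
unmatched₀-chainAt zero    (true ∷ x)  _
  rewrite unmatched₁-chainAt 0 x z≤n = cong suc (unmatched₀-chainAt 0 x z≤n)
unmatched₀-chainAt (suc k) (true ∷ x)  (s≤s p) =
  trans (+-suc (unmatched₀ (chainAt k x)) k) (cong suc (unmatched₀-chainAt k x p))
unmatched₀-chainAt k (false ∷ x) p
  with unmatched₁ x | unmatched₀-chainAt (pred k) x | unmatched₀-chainAt (suc k) x
     | unmatched₁-chainAt (suc k) x
unmatched₀-chainAt zero    (false ∷ x) _       | zero  | ih | _ | _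
  rewrite unmatched₁-chainAt 0 x z≤n = cong suc (ih z≤n)
unmatched₀-chainAt (suc k) (false ∷ x) (s≤s p) | zero  | ih | _  | _ =
  trans (+-suc (unmatched₀ (chainAt k x)) k) (cong suc (ih p))
unmatched₀-chainAt k       (false ∷ x) p       | suc _ | _  | ih | u₁≡
  rewrite u₁≡ (s≤s p) =
  suc-injective (trans (sym (+-suc (unmatched₀ (chainAt (suc k) x)) k)) (ih (s≤s p)))

matched-chainAt : ∀ {n} k (x : Cube n) → k ≤ unmatched x → matched (chainAt k x) ≡ matched x
matched-chainAt zero    []          _       = refl
matched-chainAt zero    (true ∷ x)  _
  rewrite unmatched₁-chainAt 0 x z≤n = matched-chainAt 0 x z≤n
matched-chainAt (suc k) (true ∷ x)  (s≤s p) = matched-chainAt k x p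
matched-chainAt k (false ∷ x) p
  with unmatched₁ x | matched-chainAt (pred k) x | matched-chainAt (suc k) x
     | unmatched₁-chainAt (suc k) x
matched-chainAt zero    (false ∷ x) _       | zero  | ih | _  | _
  rewrite unmatched₁-chainAt 0 x z≤n = ih z≤n
matched-chainAt (suc k) (false ∷ x) (s≤s p) | zero  | ih | _  | _ = ih p
matched-chainAt k       (false ∷ x) p       | suc _ | _  | ih | u₁≡
  rewrite u₁≡ (s≤s p) = cong suc (ih (s≤s p))

chainAt-chainAt : ∀ {n} j k (x : Cube n) → k ≤ unmatched x →
  chainAt j (chainAt k x) ≡ chainAt j x
chainAt-chainAt j zero    []          _       = refl
chainAt-chainAt j zero    (true ∷ x)  _
  rewrite unmatched₁-chainAt 0 x z≤n = cong ((0 <ᵇ j) ∷_) (chainAt-chainAt (pred j) 0 x z≤n)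
chainAt-chainAt j (suc k) (true ∷ x)  (s≤s p) =
  cong ((0 <ᵇ j) ∷_) (chainAt-chainAt (pred j) k x p)
chainAt-chainAt j k (false ∷ x) p
  with unmatched₁ x | chainAt-chainAt (pred j) (pred k) x | chainAt-chainAt (suc j) (suc k) x
     | unmatched₁-chainAt (suc k) x
chainAt-chainAt j zero    (false ∷ x) _       | zero  | ih | _  | _
  rewrite unmatched₁-chainAt 0 x z≤n = cong ((0 <ᵇ j) ∷_) (ih z≤n)
chainAt-chainAt j (suc k) (false ∷ x) (s≤s p) | zero  | ih | _  | _ = cong ((0 <ᵇ j) ∷_) (ih p)
chainAt-chainAt j k       (false ∷ x) p       | suc _ | _  | ih | u₁≡
  rewrite u₁≡ (s≤s p) = cong (false ∷_) (ih (s≤s p))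

dist-chainAt : ∀ {n} k (x : Cube n) → k ≤ unmatched x →
  dist x (chainAt k x) ≡ ∣ k - unmatched₁ x ∣
dist-chainAt zero    []          _       = refl
dist-chainAt zero    (true ∷ x)  _       = cong suc (dist-chainAt 0 x z≤n)
dist-chainAt (suc k) (true ∷ x)  (s≤s p) = dist-chainAt k x p
dist-chainAt k (false ∷ x) p
  with unmatched₁ x | dist-chainAt (pred k) x | dist-chainAt (suc k) x
dist-chainAt zero    (false ∷ x) _       | zero  | ih | _  = ih z≤n
dist-chainAt (suc k) (false ∷ x) (s≤s p) | zero  | ih | _  =
  cong suc (trans (ih p) (∣-∣-identityʳ k))
dist-chainAt k       (false ∷ x) p       | suc _ | _  | ih = ih (s≤s p)

reflect : ∀ {n} → Cube n → Cube n
reflect x = chainAt (unmatched₀ x) x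

module _ {n} (x : Cube n) where

  private
    u₀≤u : unmatched₀ x ≤ unmatched x
    u₀≤u = m≤n+m (unmatched₀ x) (unmatched₁ x)

  unmatched₁-reflect : unmatched₁ (reflect x) ≡ unmatched₀ x
  unmatched₁-reflect = unmatched₁-chainAt (unmatched₀ x) x u₀≤u

  unmatched₀-reflect : unmatched₀ (reflect x) ≡ unmatched₁ x
  unmatched₀-reflect =
    +-cancelʳ-≡ (unmatched₀ x) _ _ (unmatched₀-chainAt (unmatched₀ x) x u₀≤u)

  reflect-involutive : reflect (reflect x) ≡ x
  reflect-involutive = begin
    chainAt (unmatched₀ (reflect x)) (reflect x)
      ≡⟨ cong (λ k → chainAt k (reflect x)) unmatched₀-reflect ⟩
    chainAt (unmatched₁ x) (reflect x)
      ≡⟨ chainAt-chainAt (unmatched₁ x) (unmatched₀ x) x u₀≤u ⟩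
    chainAt (unmatched₁ x) x
      ≡⟨ chainAt-unmatched₁ x ⟩
    x ∎
    where open ≡-Reasoning

  weight-reflect : weight (reflect x) ≡ zeros x
  weight-reflect = begin
    weight (reflect x)
      ≡⟨ weight≡matched+unmatched₁ (reflect x) ⟩
    matched (reflect x) + unmatched₁ (reflect x)
      ≡⟨ cong₂ _+_ (matched-chainAt (unmatched₀ x) x u₀≤u) unmatched₁-reflect ⟩
    matched x + unmatched₀ x
      ≡⟨ zeros≡matched+unmatched₀ x ⟨
    zeros x ∎
    where open ≡-Reasoning

  dist-reflect : dist x (reflect x) ≡ imbalance x
  dist-reflect = begin
    dist x (reflect x)
      ≡⟨ dist-chainAt (unmatched₀ x) x u₀≤u ⟩
    ∣ unmatched₀ x - unmatched₁ x ∣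
      ≡⟨ sym (∣m+n-m+o∣≡∣n-o∣ (matched x) _ _) ⟩
    ∣ matched x + unmatched₀ x - matched x + unmatched₁ x ∣
      ≡⟨ cong₂ ∣_-_∣ (zeros≡matched+unmatched₀ x) (weight≡matched+unmatched₁ x) ⟨
    ∣ zeros x - weight x ∣
      ≡⟨ ∣-∣-comm (zeros x) (weight x) ⟩
    imbalance x ∎
    where open ≡-Reasoning

oddᵇ : ℕ → Bool
oddᵇ zero    = false
oddᵇ (suc n) = not (oddᵇ n)

oddᵇ-+ : ∀ m n → oddᵇ (m + n) ≡ oddᵇ m xor oddᵇ n
oddᵇ-+ zero    n = refl
oddᵇ-+ (suc m) n = trans (cong not (oddᵇ-+ m n)) (not-distribˡ-xor (oddᵇ m) (oddᵇ n))

XOR≡oddᵇ-weight : ∀ {n} (x : Cube n) → XOR x ≡ oddᵇ (weight x)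
XOR≡oddᵇ-weight []          = refl
XOR≡oddᵇ-weight (true ∷ x)  = cong not (XOR≡oddᵇ-weight x)
XOR≡oddᵇ-weight (false ∷ x) = XOR≡oddᵇ-weight x

xor≡true⇒≡not : ∀ {a b} → a xor b ≡ true → b ≡ not a
xor≡true⇒≡not {true}  {false} _ = refl
xor≡true⇒≡not {false} {true}  _ = refl

oddᵇ-complement : ∀ k w z → w + z ≡ suc (k + k) → oddᵇ z ≡ not (oddᵇ w)
oddᵇ-complement k w z w+z≡1+2k = xor≡true⇒≡not (begin
  oddᵇ w xor oddᵇ z   ≡⟨ sym (oddᵇ-+ w z) ⟩
  oddᵇ (w + z)        ≡⟨ cong oddᵇ w+z≡1+2k ⟩
  not (oddᵇ (k + k))  ≡⟨ cong not (trans (oddᵇ-+ k k) (xor-same (oddᵇ k))) ⟩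
  true                ∎)
  where open ≡-Reasoning

2*[1+k]≡2+[k+k] : ∀ k → 2 * suc k ≡ suc (suc (k + k))
2*[1+k]≡2+[k+k] = solve-∀

1+2k<2w⇒k<w : ∀ k w → suc (k + k) < 2 * w → k < w
1+2k<2w⇒k<w k w 1+2k<2w = *-cancelˡ-≤ 2 (subst (_≤ 2 * w) (sym (2*[1+k]≡2+[k+k] k)) 1+2k<2w)

2w≤1+2k⇒w≤k : ∀ k w → 2 * w ≤ suc (k + k) → w ≤ k
2w≤1+2k⇒w≤k k w 2w≤1+2k =
  s≤s⁻¹ (*-cancelˡ-< 2 w (suc k) (subst (2 * w <_) (sym (2*[1+k]≡2+[k+k] k)) (s≤s 2w≤1+2k)))

<ᵇ-complement : ∀ k w z → w + z ≡ suc (k + k) →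
  (suc (k + k) <ᵇ 2 * z) ≡ not (suc (k + k) <ᵇ 2 * w)
<ᵇ-complement k w z w+z≡1+2k
  with suc (k + k) <ᵇ 2 * w | <ᵇ-reflects-< (suc (k + k)) (2 * w)
     | suc (k + k) <ᵇ 2 * z | <ᵇ-reflects-< (suc (k + k)) (2 * z)
... | true  | ofʸ 1+2k<2w | true  | ofʸ 1+2k<2z = contradiction (begin-strict
  suc (k + k)      <⟨ n<1+n (suc (k + k)) ⟩
  suc (suc k + k)  ≡⟨ cong suc (sym (+-suc k k)) ⟩
  suc k + suc k    ≤⟨ +-mono-≤ (1+2k<2w⇒k<w k w 1+2k<2w) (1+2k<2w⇒k<w k z 1+2k<2z) ⟩
  w + z            ≡⟨ w+z≡1+2k ⟩
  suc (k + k)      ∎) (<-irrefl refl)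
  where open ≤-Reasoning
... | true  | _           | false | _           = refl
... | false | _           | true  | _           = refl
... | false | ofⁿ 1+2k≮2w | false | ofⁿ 1+2k≮2z = contradiction (begin
  suc (k + k)      ≡⟨ w+z≡1+2k ⟨
  w + z            ≤⟨ +-mono-≤ (2w≤1+2k⇒w≤k k w (≮⇒≥ 1+2k≮2w))
                               (2w≤1+2k⇒w≤k k z (≮⇒≥ 1+2k≮2z)) ⟩
  k + k            ∎) (<-irrefl refl)
  where open ≤-Reasoning

%2≡1⇒≡1+[k+k] : ∀ {n} → n % 2 ≡ 1 → n ≡ suc (n / 2 + n / 2)
%2≡1⇒≡1+[k+k] {n} n%2≡1 = begin
  n                    ≡⟨ m≡m%n+[m/n]*n n 2 ⟩
  n % 2 + n / 2 * 2    ≡⟨ cong₂ _+_ n%2≡1 (*-comm (n / 2) 2) ⟩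
  1 + 2 * (n / 2)      ≡⟨ cong (λ m → suc (n / 2 + m)) (+-identityʳ (n / 2)) ⟩
  suc (n / 2 + n / 2)  ∎
  where open ≡-Reasoning

m^2≡m*m : ∀ m → m ^ 2 ≡ m * m
m^2≡m*m m = cong (m *_) (*-identityʳ m)

4^n≡2^n*2^n : ∀ n → 4 ^ n ≡ 2 ^ n * 2 ^ n
4^n≡2^n*2^n n = begin
  4 ^ n          ≡⟨ ^-*-assoc 2 2 n ⟩
  2 ^ (2 * n)    ≡⟨ cong (2 ^_) (*-comm 2 n) ⟩
  2 ^ (n * 2)    ≡⟨ ^-*-assoc 2 n 2 ⟨
  (2 ^ n) ^ 2    ≡⟨ m^2≡m*m (2 ^ n) ⟩
  2 ^ n * 2 ^ n  ∎
  where open ≡-Reasoning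

stretch-arithmetic : ∀ {n T} N S → 1 ≤ n → T ≤ n * (2 * S + 3 * N) → S * S ≤ N * (n * N) →
  T * T ≤ 36 * (n * (n * n)) * (N * N)
stretch-arithmetic {n} {T} N S 1≤n T≤ S²≤ = begin
  T * T
    ≤⟨ *-mono-≤ T≤ T≤ ⟩
  (n * u) * (n * u)
    ≡⟨ reassoc n u ⟩
  (n * n) * (u * u)
    ≤⟨ *-monoʳ-≤ (n * n) ([m+n]²≤2[m²+n²] (2 * S) (3 * N)) ⟩
  (n * n) * (2 * (2 * S * (2 * S) + 3 * N * (3 * N)))
    ≡⟨ cong (n * n *_) (expand S N) ⟩
  (n * n) * (8 * (S * S) + 18 * (N * N))
    ≤⟨ *-monoʳ-≤ (n * n) (+-mono-≤ (*-monoʳ-≤ 8 S²≤) (*-monoʳ-≤ 18 N²≤nN²)) ⟩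
  (n * n) * (8 * (N * (n * N)) + 18 * (n * (N * N)))
    ≡⟨ collect n N ⟩
  26 * (n * (n * n)) * (N * N)
    ≤⟨ *-monoˡ-≤ (N * N) (*-monoˡ-≤ (n * (n * n)) (m≤m+n 26 10)) ⟩
  36 * (n * (n * n)) * (N * N) ∎
  where
  open ≤-Reasoning
  u = 2 * S + 3 * N
  N²≤nN² : N * N ≤ n * (N * N)
  N²≤nN² = ≤-trans (≤-reflexive (sym (*-identityˡ (N * N)))) (*-monoˡ-≤ (N * N) 1≤n)
  reassoc : ∀ n u → (n * u) * (n * u) ≡ (n * n) * (u * u)
  reassoc = solve-∀
  expand : ∀ S N → 2 * (2 * S * (2 * S) + 3 * N * (3 * N)) ≡ 8 * (S * S) + 18 * (N * N)
  expand = solve-∀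
  collect : ∀ n N →
    (n * n) * (8 * (N * (n * N)) + 18 * (n * (N * N))) ≡ 26 * (n * (n * n)) * (N * N)
  collect = solve-∀

-- The mapping

module _ {n : ℕ} (n-odd : n % 2 ≡ 1) where

  private
    k : ℕ
    k = n / 2

    n≡1+2k : n ≡ suc (k + k)
    n≡1+2k = %2≡1⇒≡1+[k+k] n-odd

    weight+zeros≡1+2k : (x : Cube n) → weight x + zeros x ≡ suc (k + k)
    weight+zeros≡1+2k x = trans (weight+zeros≡n x) n≡1+2k

  XOR-reflect : (x : Cube n) → XOR (reflect x) ≡ not (XOR x)
  XOR-reflect x = begin
    XOR (reflect x)            ≡⟨ XOR≡oddᵇ-weight (reflect x) ⟩
    oddᵇ (weight (reflect x))  ≡⟨ cong oddᵇ (weight-reflect x) ⟩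
    oddᵇ (zeros x)             ≡⟨ oddᵇ-complement k (weight x) (zeros x) (weight+zeros≡1+2k x) ⟩
    not (oddᵇ (weight x))      ≡⟨ cong not (XOR≡oddᵇ-weight x) ⟨
    not (XOR x)                ∎
    where open ≡-Reasoning

  Majority-reflect : (x : Cube n) → Majority (reflect x) ≡ not (Majority x)
  Majority-reflect x = begin
    n <ᵇ 2 * weight (reflect x)
      ≡⟨ cong (λ w → n <ᵇ 2 * w) (weight-reflect x) ⟩
    n <ᵇ 2 * zeros x
      ≡⟨ cong (λ m → m <ᵇ 2 * zeros x) n≡1+2k ⟩
    suc (k + k) <ᵇ 2 * zeros x
      ≡⟨ <ᵇ-complement k (weight x) (zeros x) (weight+zeros≡1+2k x) ⟩
    not (suc (k + k) <ᵇ 2 * weight x)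
      ≡⟨ cong (λ m → not (m <ᵇ 2 * weight x)) n≡1+2k ⟨
    not (n <ᵇ 2 * weight x) ∎
    where open ≡-Reasoning

  toMajority : Cube n → Cube n
  toMajority x with XOR x ≟ Majority x
  ... | yes _ = x
  ... | no  _ = reflect x

  toMajority-agree : ∀ x → XOR x ≡ Majority x → toMajority x ≡ x
  toMajority-agree x agree with XOR x ≟ Majority x
  ... | yes _        = refl
  ... | no  disagree = contradiction agree disagree

  toMajority-disagree : ∀ x → XOR x ≢ Majority x → toMajority x ≡ reflect x
  toMajority-disagree x disagree with XOR x ≟ Majority x
  ... | yes agree = contradiction agree disagree
  ... | no  _     = refl

  toMajority-respects : ∀ x → XOR x ≡ Majority (toMajority x)
  toMajority-respects x with XOR x ≟ Majority x
  ... | yes agree    = agree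
  ... | no  disagree = trans (¬-not disagree) (sym (Majority-reflect x))

  toMajority-involutive : ∀ x → toMajority (toMajority x) ≡ x
  toMajority-involutive x with XOR x ≟ Majority x
  ... | yes agree    = toMajority-agree x agree
  ... | no  disagree =
    trans (toMajority-disagree (reflect x) reflect-disagrees) (reflect-involutive x)
    where
    reflect-disagrees : XOR (reflect x) ≢ Majority (reflect x)
    reflect-disagrees eq =
      disagree (not-injective (trans (sym (XOR-reflect x)) (trans eq (Majority-reflect x))))

  toMajorityMapping : Mapping n XOR Majority
  toMajorityMapping = record
    { φ        = ↔⇒⤖ (mk↔ₛ′ toMajority toMajority toMajority-involutive toMajority-involutive)
    ; respects = toMajority-respects
    }

  dist-toMajority : ∀ x → dist x (toMajority x) ≤ imbalance x
  dist-toMajority x with XOR x ≟ Majority x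
  ... | yes _ = ≤-trans (≤-reflexive (dist-self x)) z≤n
  ... | no  _ = ≤-reflexive (dist-reflect x)

  toMajority-stretch : ∀ x (i : Fin n) →
    dist (toMajority x) (toMajority (flipAt i x)) ≤ 2 * imbalance x + 3
  toMajority-stretch x i = begin
    dist (toMajority x) (toMajority y)
      ≤⟨ dist-triangle (toMajority x) x (toMajority y) ⟩
    dist (toMajority x) x + dist x (toMajority y)
      ≤⟨ +-mono-≤ (≤-reflexive (dist-sym (toMajority x) x)) (dist-triangle x y (toMajority y)) ⟩
    dist x (toMajority x) + (dist x y + dist y (toMajority y))
      ≤⟨ +-mono-≤ (dist-toMajority x)
                  (+-mono-≤ (≤-reflexive (dist-flipAt i x)) (dist-toMajority y)) ⟩
    imbalance x + (1 + imbalance y)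
      ≤⟨ +-monoʳ-≤ (imbalance x) (+-monoʳ-≤ 1 (imbalance-flipAt i x)) ⟩
    imbalance x + (1 + (imbalance x + 2))
      ≡⟨ collect (imbalance x) ⟩
    2 * imbalance x + 3 ∎
    where
    open ≤-Reasoning
    y = flipAt i x
    collect : ∀ d → d + (1 + (d + 2)) ≡ 2 * d + 3
    collect = solve-∀

  totalStretch-toMajority :
    totalStretch toMajority ≤ n * (2 * ∑ (allCube n) imbalance + 3 * 2 ^ n)
  totalStretch-toMajority = begin
    ∑ (allCube n) (λ x → ∑ (allFin n) (λ i → dist (toMajority x) (toMajority (flipAt i x))))
      ≤⟨ ∑-mono-≤ (allCube n) (λ x → ∑-≤-length-* (allFin n) (toMajority-stretch x)) ⟩
    ∑ (allCube n) (λ x → length (allFin n) * (2 * imbalance x + 3))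
      ≡⟨ ∑-*ˡ (allCube n) (length (allFin n)) (λ x → 2 * imbalance x + 3) ⟩
    length (allFin n) * ∑ (allCube n) (λ x → 2 * imbalance x + 3)
      ≡⟨ cong₂ _*_ (length-tabulate {n = n} id) ∑-affine ⟩
    n * (2 * ∑ (allCube n) imbalance + 3 * 2 ^ n) ∎
    where
    open ≤-Reasoning
    ∑-affine : ∑ (allCube n) (λ x → 2 * imbalance x + 3) ≡ 2 * ∑ (allCube n) imbalance + 3 * 2 ^ n
    ∑-affine = begin-equality
      ∑ (allCube n) (λ x → 2 * imbalance x + 3)
        ≡⟨ ∑-+ (allCube n) _ _ ⟩
      ∑ (allCube n) (λ x → 2 * imbalance x) + ∑ (allCube n) (λ _ → 3)
        ≡⟨ cong₂ _+_ (∑-*ˡ (allCube n) 2 imbalance) (∑-const (allCube n) 3) ⟩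
      2 * ∑ (allCube n) imbalance + length (allCube n) * 3
        ≡⟨ cong (λ ℓ → 2 * ∑ (allCube n) imbalance + ℓ * 3) (length-allCube n) ⟩
      2 * ∑ (allCube n) imbalance + 2 ^ n * 3
        ≡⟨ cong (2 * ∑ (allCube n) imbalance +_) (*-comm (2 ^ n) 3) ⟩
      2 * ∑ (allCube n) imbalance + 3 * 2 ^ n ∎

  ∑-imbalance-squared≤ :
    ∑ (allCube n) imbalance * ∑ (allCube n) imbalance ≤ 2 ^ n * (n * 2 ^ n)
  ∑-imbalance-squared≤ =
    subst₂ (λ N q → ∑ (allCube n) imbalance * ∑ (allCube n) imbalance ≤ N * q)
      (length-allCube n) (∑-imbalance² n) (∑²≤length*∑² (allCube n) imbalance)

  totalStretch-toMajority² : totalStretch toMajority ^ 2 ≤ 6 ^ 2 * n ^ 3 * 4 ^ n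
  totalStretch-toMajority² = begin
    totalStretch toMajority ^ 2
      ≡⟨ m^2≡m*m (totalStretch toMajority) ⟩
    totalStretch toMajority * totalStretch toMajority
      ≤⟨ stretch-arithmetic (2 ^ n) (∑ (allCube n) imbalance)
           (subst (1 ≤_) (sym n≡1+2k) (s≤s z≤n)) totalStretch-toMajority ∑-imbalance-squared≤ ⟩
    36 * (n * (n * n)) * (2 ^ n * 2 ^ n)
      ≡⟨ cong₂ (λ c N → 36 * c * N) (cong (n *_) (m^2≡m*m n)) (4^n≡2^n*2^n n) ⟨
    6 ^ 2 * n ^ 3 * 4 ^ n ∎
    where open ≤-Reasoning

theorem1p2 : ∃[ c ] (0 < c × (∀ (n : ℕ) → n % 2 ≡ 1 →
    ∃[ m ] (totalStretch (Bijection.to (Mapping.φ {n} {XOR} {Majority} m)) ^ 2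
    ≤ (c ^ 2) * (n ^ 3) * (4 ^ n))))
theorem1p2 = 6 , s≤s z≤n , λ n n-odd → toMajorityMapping n-odd , totalStretch-toMajority² {n} n-odd
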